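{- In the setting below, let $v$ be a node of $G$ and $X$ a set of nodes with $v\circ\!\!\to X$ or $X\to\!\bullet\, v$. Then for every node $v'$ with $v\,\bar{\mathcal{C}}\,v'$ we have $w\,\bar{\mathcal{C}}\,v'$ for every $w\in X$. Conversely, if $v'$ is a node with $w\,\bar{\mathcal{C}}\,v'$ for every $w\in X$, then $v\,\bar{\mathcal{C}}\,v'$.
   Context: Petri nets. A Petri net is $N=(P,T,\mathbf{pre},\mathbf{post})$ with finite disjoint sets of places $P$ and transitions $T$ and $\mathbf{pre},\mathbf{post}:T\to(P\to\mathbb{N})$. A marking is $m:P\to\mathbb{N}$. Transition $t$ is enabled at $m$ if $m(p)\ge\mathbf{pre}(t,p)$ for all $p$; firing it yields $m'=m-\mathbf{pre}(t)+\mathbf{post}(t)$. $R(N,m_0)$ is the set of markings reachable from $m_0$. $(N,m_0)$ is safe if every reachable marking has $m(p)\le1$ for all $p$. Equations. Solutions of a linear system $E$ (variables $\mathrm{fv}(E)$) are total non-negative integer assignments satisfying all equations; $E$ is consistent if it has one. Fix pairwise disjoint sets $K(n)$, $n\in\mathbb{N}$, of constant symbols, $K=\bigcup_n K(n)$; a constant in $K(n)$ stands for $n$. Every equation of $E$ has the form $v=\sum_{x\in X}x$ with $X$ a nonempty finite set of variables and $v$ a variable or constant. For a partial map $m$ defined exactly on $x_1,\dots,x_k$, $\llbracket m\rrbracket$ is the system $x_1=m(x_1),\dots,x_k=m(x_k)$; commas denote union of systems. $E$-equivalence: $(N_1,m_1)\vartriangleright_E(N_2,m_2)$ iff (A1)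 $E,\llbracket m\rrbracket$ is consistent for every $m\in R(N_1,m_1)\cup R(N_2,m_2)$; (A2) $E,\llbracket m_1\rrbracket,\llbracket m_2\rrbracket$ is consistent; (A3) for all markings $m_1'$ of $N_1$, $m_2'$ of $N_2$ with $E,\llbracket m_1'\rrbracket,\llbracket m_2'\rrbracket$ consistent, $m_1'\in R(N_1,m_1)$ iff $m_2'\in R(N_2,m_2)$. Token Flow Graphs. A TFG is $(V,R,A)$ with $V=P\cup S$, $S\subset K$ finite, disjoint $R,A\subseteq V\times V$. Write $v\to\!\bullet\, w$ for $(v,w)\in R$, $v\circ\!\!\to w$ for $(v,w)\in A$, $v\to w$ for either, $\to^\star$ for the reflexive-transitive closure. A root is a node that is the target of no arc. $v\circ\!\!\to X$ means $X$ is the nonempty set of all $w$ with $v\circ\!\!\to w$; $X\to\!\bullet\, v$ means $X$ is the nonempty set of all $w$ with $w\to\!\bullet\, v$. Well-formed for $(N_1,m_1)\vartriangleright_E(N_2,m_2)$ (place sets $P_1,P_2$): (T1) $V\setminus K=P_1\cup P_2\cup\mathrm{fv}(E)$; (T2) nodes in $V\cap K$ are roots; (T3) one cannot have $p\circ\!\!\to q$ and $p'\to q$ with $p\ne p'$, nor both $p\to\!\bullet\, q$ and $p\circ\!\!\to q$; (T4) $v\circ\!\!\to X$ or $X\to\!\bullet\, v$ iff the equation $v=\sum_{x\in X}x$ is in $E$. Configurations. A configuration is a partial $c:V\to\mathbb{N}$ with $c(v)=n$ for $v\in V\cap K(n)$; total if defined everywhere; $c_{\mid N}$ is its restriction to places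 of $N$. Well-defined: (CBot) if $v\to w$, $c(v)$ undefined iff $c(w)$ undefined; (CEq) if $c(v)$ defined and ($v\circ\!\!\to X$ or $X\to\!\bullet\, v$), $c(v)=\sum_{x\in X}c(x)$. Setting: $(N_1,m_1)\vartriangleright_E(N_2,m_2)$ with both nets safe; $G$ is a well-formed TFG for it; every constant node lies in $K(0)\cup K(1)$; every root is a constant or a place of $N_2$; every node has a path to a place of $N_1$. The concurrency relation $\mathcal{C}$ of $G$: $v\,\mathcal{C}\,w$ iff there is a total, well-defined configuration $c$ with $c_{\mid N_2}\in R(N_2,m_2)$, $c(v)>0$ and $c(w)>0$. $v\,\bar{\mathcal{C}}\,w$ means not $v\,\mathcal{C}\,w$. -}

module Defs where

open import Data.Nat using (ℕ; zero; suc; _+_; _∸_; _≤_; _<_)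
open import Data.Fin using (Fin)
open import Data.List using (List; []; _∷_; map)
open import Data.Nat.ListAction using (sum)
open import Data.List.Membership.Propositional using (_∈_)
open import Data.List.Relation.Unary.All using (All)
open import Data.List.Relation.Unary.Any using (Any)
open import Data.List.Relation.Unary.Unique.Propositional using (Unique)
open import Data.Maybe using (Maybe; just; nothing; fromMaybe)
open import Data.Product using (Σ; ∃; _×_; _,_; ∃-syntax)
open import Data.Sum using (_⊎_)
open import Data.Empty using (⊥)
open import Relation.Nullary using (¬_)
open import Relation.Binary.PropositionalEquality using (_≡_; _≢_)
open import Relation.Binary.Construct.Closure.ReflexiveTransitive using (Star)
open import Function.Bundles using (_⇔_)

-- Variables (and places, which are variables) are named by ℕ.
-- Constant symbols: `con n i` is the i-th constant symbol of K(n);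
-- the sets K(n) = { con n i | i ∈ ℕ } are pairwise disjoint and stand for n.

data Node : Set where
  var : ℕ → Node
  con : ℕ → ℕ → Node

-- Markings are functions ℕ → ℕ of which only the values
-- on the places of the net are meaningful (all notions below only look
-- at those values).

record Net : Set where
  field
    places        : List ℕ
    places-unique : Unique places
    nTrans        : ℕ
    pre post      : Fin nTrans → ℕ → ℕ

open Net public

Marking : Set
Marking = ℕ → ℕ

SameMarking : Net → Marking → Marking → Set
SameMarking N m m' = ∀ p → p ∈ places N → m p ≡ m' p

Enabled : (N : Net) → Fin (nTrans N) → Marking → Set
Enabled N t m = ∀ p → p ∈ places N → pre N t p ≤ m p

Fires : (N : Net) → Marking → Fin (nTrans N) → Marking → Set
Fires N m t m' =
  Enabled N t m × (∀ p → p ∈ places N → m' p ≡ (m p ∸ pre N t p) + post N t p)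

data Reach (N : Net) (m0 : Marking) : Marking → Set where
  base : ∀ {m} → SameMarking N m m0 → Reach N m0 m
  step : ∀ {m t m'} → Reach N m0 m → Fires N m t m' → Reach N m0 m'

Safe : Net → Marking → Set
Safe N m0 = ∀ m → Reach N m0 m → ∀ p → p ∈ places N → m p ≤ 1

-- Linear systems.  An equation  v = Σ_{x ∈ X} x  with v a variable or a
-- constant and X a nonempty finite set of variables.

record Equation : Set where
  field
    lhs          : Node
    rhs          : List ℕ
    rhs-nonempty : rhs ≢ []
    rhs-unique   : Unique rhs

open Equation public

System : Set
System = List Equation

val : (ℕ → ℕ) → Node → ℕ
val σ (var x)   = σ x
val σ (con n i) = n

Sat : System → (ℕ → ℕ) → Set
Sat E σ = All (λ e → val σ (lhs e) ≡ sum (map σ (rhs e))) E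

_∈fv_ : ℕ → System → Set
x ∈fv E = Any (λ e → (lhs e ≡ var x) ⊎ (x ∈ rhs e)) E

Consistent1 : System → Net → Marking → Set
Consistent1 E N m = ∃[ σ ] (Sat E σ × (∀ p → p ∈ places N → σ p ≡ m p))

Consistent2 : System → Net → Marking → Net → Marking → Set
Consistent2 E N₁ m₁ N₂ m₂ =
  ∃[ σ ] (Sat E σ × (∀ p → p ∈ places N₁ → σ p ≡ m₁ p)
                  × (∀ p → p ∈ places N₂ → σ p ≡ m₂ p))

EEquiv : System → Net → Marking → Net → Marking → Set
EEquiv E N₁ m₁ N₂ m₂ =
  ((∀ m → Reach N₁ m₁ m → Consistent1 E N₁ m) ×
   (∀ m → Reach N₂ m₂ m → Consistent1 E N₂ m)) ×
  Consistent2 E N₁ m₁ N₂ m₂ ×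
  (∀ m₁' m₂' → Consistent2 E N₁ m₁' N₂ m₂' →
     (Reach N₁ m₁ m₁' ⇔ Reach N₂ m₂ m₂'))

-- Token flow graphs.  V is a finite set of nodes; R (v →• w) and
-- A (v ∘→ w) are disjoint relations on V.  S = the constant nodes of V.

record TFG : Set₁ where
  field
    V     : List Node
    R     : Node → Node → Set
    A     : Node → Node → Set
    R⊆V   : ∀ {v w} → R v w → (v ∈ V) × (w ∈ V)
    A⊆V   : ∀ {v w} → A v w → (v ∈ V) × (w ∈ V)
    R∩A=∅ : ∀ {v w} → R v w → A v w → ⊥

open TFG public

Arc : TFG → Node → Node → Set
Arc G v w = R G v w ⊎ A G v w

OutA : TFG → Node → List Node → Set
OutA G v X = (X ≢ []) × Unique X × (∀ w → (w ∈ X) ⇔ A G v w)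

InR : TFG → List Node → Node → Set
InR G X v = (X ≢ []) × Unique X × (∀ w → (w ∈ X) ⇔ R G w v)

EqIn : System → Node → List Node → Set
EqIn E v X = Any (λ e → (lhs e ≡ v) × (∀ u → (u ∈ X) ⇔ (u ∈ map var (rhs e)))) E

WellFormed : System → Net → Net → TFG → Set
WellFormed E N₁ N₂ G =
  (∀ x → (var x ∈ V G) ⇔ ((x ∈ places N₁) ⊎ (x ∈ places N₂) ⊎ (x ∈fv E))) ×
  (∀ n i → con n i ∈ V G → ∀ u → ¬ Arc G u (con n i)) ×
  ((∀ p p' q → A G p q → Arc G p' q → p ≡ p') ×
   (∀ p q → R G p q → A G p q → ⊥)) ×
  (∀ v X → Unique X → ((OutA G v X ⊎ InR G X v) ⇔ EqIn E v X))

-- Configurations: partial maps Node → ℕ (only values on V matter).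

Config : Set
Config = Node → Maybe ℕ

IsConfig : TFG → Config → Set
IsConfig G c = ∀ n i → con n i ∈ V G → c (con n i) ≡ just n

Total : TFG → Config → Set
Total G c = ∀ v → v ∈ V G → ∃[ n ] (c v ≡ just n)

msum : List (Maybe ℕ) → Maybe ℕ
msum []             = just 0
msum (nothing ∷ xs) = nothing
msum (just n ∷ xs)  with msum xs
... | nothing = nothing
... | just k  = just (n + k)

WellDefined : TFG → Config → Set
WellDefined G c =
  (∀ v w → Arc G v w → ((c v ≡ nothing) ⇔ (c w ≡ nothing))) ×
  (∀ v n X → c v ≡ just n → (OutA G v X ⊎ InR G X v) →
     msum (map c X) ≡ just n)

restrict : Config → Marking
restrict c p = fromMaybe 0 (c (var p))

Pos : Config → Node → Set
Pos c v = ∃[ n ] ((c v ≡ just n) × (0 < n))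

Conc : Net → Marking → TFG → Node → Node → Set
Conc N₂ m₂ G v w =
  ∃[ c ] (IsConfig G c × Total G c × WellDefined G c ×
          Reach N₂ m₂ (restrict c) × Pos c v × Pos c w)

Setting : System → Net → Marking → Net → Marking → TFG → Set
Setting E N₁ m₁ N₂ m₂ G =
  EEquiv E N₁ m₁ N₂ m₂ ×
  Safe N₁ m₁ × Safe N₂ m₂ ×
  WellFormed E N₁ N₂ G ×
  (∀ n i → con n i ∈ V G → n ≤ 1) ×
  (∀ v → v ∈ V G → (∀ u → ¬ Arc G u v) →
     (∃[ n ] ∃[ i ] (v ≡ con n i)) ⊎ (∃[ p ] ((v ≡ var p) × (p ∈ places N₂)))) ×
  (∀ v → v ∈ V G → ∃[ p ] ((p ∈ places N₁) × Star (Arc G) v (var p)))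

{-# OPTIONS --safe #-}
module Submission where

open import Defs
open import Data.List using (List; []; _∷_; map)
open import Data.List.Membership.Propositional using (_∈_; find; lose)
open import Data.List.Relation.Unary.Any using (Any; here; there)
open import Data.List.Relation.Unary.Any.Properties using (map⁺; map⁻)
open import Data.Sum using (_⊎_)
open import Data.Product using (_×_; _,_; proj₂; ∃-syntax)
open import Data.Maybe using (Maybe; just; nothing)
open import Data.Nat using (ℕ; zero; suc; _<_; z≤n; s≤s)
open import Data.Nat.Properties using (<-≤-trans; m≤m+n; m≤n+m)
open import Relation.Nullary using (¬_)
open import Relation.Binary.PropositionalEquality using (_≡_; refl)

Positive : Maybe ℕ → Set
Positive m = ∃[ k ] (m ≡ just k × 0 < k)

msum-positive⁺ : ∀ xs {n} → msum xs ≡ just n → Any Positive xs → 0 < n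
msum-positive⁺ (nothing ∷ xs) () _
msum-positive⁺ (just m ∷ xs) eq p with msum xs in e
msum-positive⁺ (just m ∷ xs) refl (here (k , refl , 0<k)) | just j = <-≤-trans 0<k (m≤m+n m j)
msum-positive⁺ (just m ∷ xs) refl (there p)             | just j = <-≤-trans (msum-positive⁺ xs e p) (m≤n+m j m)

msum-positive⁻ : ∀ xs {n} → msum xs ≡ just n → 0 < n → Any Positive xs
msum-positive⁻ [] refl ()
msum-positive⁻ (nothing ∷ xs) () _
msum-positive⁻ (just m ∷ xs) eq 0<n with msum xs in e
msum-positive⁻ (just zero ∷ xs)    refl 0<j | just j = there (msum-positive⁻ xs e 0<j)
msum-positive⁻ (just (suc m) ∷ xs) refl _   | just j = here (suc m , refl , s≤s z≤n)

module _ (G : TFG) {c : Config} (wd : WellDefined G c) {v : Node} {X : List Node}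
         (v=ΣX : OutA G v X ⊎ InR G X v) where

  Pos-summand⇒Pos-sum : ∀ {n} → c v ≡ just n → ∀ {w} → w ∈ X → Pos c w → Pos c v
  Pos-summand⇒Pos-sum {n} cv w∈X pos-w =
    n , cv , msum-positive⁺ (map c X) (proj₂ wd v n X cv v=ΣX) (map⁺ (lose w∈X pos-w))

  Pos-sum⇒Pos-summand : Pos c v → ∃[ w ] (w ∈ X × Pos c w)
  Pos-sum⇒Pos-summand (n , cv , 0<n) =
    find (map⁻ (msum-positive⁻ (map c X) (proj₂ wd v n X cv v=ΣX) 0<n))

module _ (G : TFG) {v : Node} {X : List Node}
         (v∈V : v ∈ V G) (v=ΣX : OutA G v X ⊎ InR G X v) {N₂ : Net} {m₂ : Marking} {v' : Node} where

  Conc-summand⇒Conc-sum : ∀ {w} → w ∈ X → Conc N₂ m₂ G w v' → Conc N₂ m₂ G v v'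
  Conc-summand⇒Conc-sum w∈X (c , isC , tot , wd , r , pos-w , pos-v') =
    c , isC , tot , wd , r , Pos-summand⇒Pos-sum G wd v=ΣX (proj₂ (tot v v∈V)) w∈X pos-w , pos-v'

  Conc-sum⇒Conc-summand : Conc N₂ m₂ G v v' → ∃[ w ] (w ∈ X × Conc N₂ m₂ G w v')
  Conc-sum⇒Conc-summand (c , isC , tot , wd , r , pos-v , pos-v') =
    let w , w∈X , pos-w = Pos-sum⇒Pos-summand G wd v=ΣX pos-v
    in  w , w∈X , (c , isC , tot , wd , r , pos-w , pos-v')

lemma12 : (E : System) (N₁ : Net) (m₁ : Marking) (N₂ : Net) (m₂ : Marking) (G : TFG) →
    Setting E N₁ m₁ N₂ m₂ G →
    (v : Node) (X : List Node) → v ∈ V G → (OutA G v X ⊎ InR G X v) →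
      ((v' : Node) → v' ∈ V G → ¬ Conc N₂ m₂ G v v' →
         (w : Node) → w ∈ X → ¬ Conc N₂ m₂ G w v')
      ×
      ((v' : Node) → v' ∈ V G → ((w : Node) → w ∈ X → ¬ Conc N₂ m₂ G w v') →
         ¬ Conc N₂ m₂ G v v')
lemma12 E N₁ m₁ N₂ m₂ G _ v X v∈V v=ΣX =
  (λ v' _ ¬v𝒞v' w w∈X w𝒞v' → ¬v𝒞v' (Conc-summand⇒Conc-sum G v∈V v=ΣX w∈X w𝒞v')) ,
  (λ v' _ ¬X𝒞v' v𝒞v' →
     let w , w∈X , w𝒞v' = Conc-sum⇒Conc-summand G v∈V v=ΣX v𝒞v' in ¬X𝒞v' w w∈X w𝒞v')
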